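{- Let $\mathcal{H}$ be an ABA-free hypergraph on a finite totally ordered vertex set $V$ such that every pair of hyperedges of $\mathcal{H}$ has a common vertex. Then there exists a set of at most two vertices of $V$ that intersects every hyperedge of $\mathcal{H}$.
   Context: A hypergraph $\mathcal{F}$ on a totally ordered finite vertex set $V$ (i.e., a family of subsets of $V$) is called ABA-free if there are no two hyperedges $A,B\in\mathcal{F}$ and three vertices $x<y<z$ such that $x,z\in A\setminus B$ and $y\in B\setminus A$. -}

module Defs where

open import Data.Nat using (ℕ) renaming (_≤_ to _≤ℕ_)
open import Data.Fin using (Fin; _<_)
open import Data.Fin.Subset using (Subset; _∈_; _∉_)
open import Data.List using (List; length)
open import Data.List.Membership.Propositional using () renaming (_∈_ to _∈ₗ_)
open import Data.Product using (∃; _×_)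
open import Relation.Nullary using (¬_)

Hypergraph : ℕ → Set
Hypergraph n = List (Subset n)

ABA-free : ∀ {n} → Hypergraph n → Set
ABA-free {n} ℱ =
  ∀ (A B : Subset n) → A ∈ₗ ℱ → B ∈ₗ ℱ → (x y z : Fin n) →
  x < y → y < z →
  ¬ ((x ∈ A × x ∉ B) × (z ∈ A × z ∉ B) × (y ∈ B × y ∉ A))

Intersecting : ∀ {n} → Hypergraph n → Set
Intersecting {n} ℱ =
  ∀ (A B : Subset n) → A ∈ₗ ℱ → B ∈ₗ ℱ → ∃ λ (v : Fin n) → v ∈ A × v ∈ B

PiercedByTwo : ∀ {n} → Hypergraph n → Set
PiercedByTwo {n} ℱ =
  ∃ λ (S : List (Fin n)) → length S ≤ℕ 2 ×
    (∀ (A : Subset n) → A ∈ₗ ℱ → ∃ λ (v : Fin n) → v ∈ₗ S × v ∈ A)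

-- Shrink a window [lo, hi] of vertices for as long as every two hyperedges
-- still meet inside it. At a window [p, q] that can be shrunk from neither
-- side, some A, B meet inside it only at p and some C, D only at q. A
-- hyperedge E missing both p and q would meet A, B, C, D strictly between p
-- and q; ABA-freeness against E then keeps p out of C, D and q out of A, B.
-- ABA-freeness also makes any two hyperedges separated (all of A ∖ B lies on
-- one side of all of B ∖ A), and a common point of B and C together with a
-- common point of A and D would then have to lie on both sides of each other.
module Submission where

open import Defs
open import Data.Nat using (ℕ; zero; suc; _+_; z≤n; s≤s; s≤s⁻¹; _≤?_; _<?_)
  renaming (_≤_ to _≤ℕ_; _<_ to _<ℕ_)
open import Data.Nat.Properties using (m≤n⇒m<n∨m≡n; m≤n⇒m≤n+o; +-suc; ≤⇒≯; <⇒≤)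
open import Data.Fin using (Fin; toℕ; _≤_; _<_)
open import Data.Fin.Properties using (toℕ<n; <-cmp; <-asym; ≤∧≢⇒<; any?)
open import Data.Fin.Subset using (Subset; _∈_; _∉_)
open import Data.Fin.Subset.Properties using (_∈?_)
open import Data.List using ([]; _∷_)
open import Data.List.Relation.Unary.All using (All; all?; lookup)
open import Data.List.Relation.Unary.All.Properties using (¬All⇒Any¬)
open import Data.List.Relation.Unary.Any using (here; there)
open import Data.List.Membership.Propositional using (find) renaming (_∈_ to _∈ₗ_)
open import Data.Product using (∃; ∃₂; _×_; _,_)
open import Data.Sum using (_⊎_; inj₁; inj₂; [_,_]′)
open import Data.Empty using (⊥; ⊥-elim)
open import Relation.Nullary using (¬_; Dec; yes; no)
open import Relation.Nullary.Decidable using (_×-dec_)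
open import Relation.Binary using (tri<; tri≈; tri>)
open import Relation.Binary.PropositionalEquality using (_≡_; _≢_; refl; sym; subst)

module _ {n : ℕ} where

  -- Windows are half-open: MeetsWithin lo hi asks for a common vertex v with lo ≤ v < hi.
  MeetsWithin : ℕ → ℕ → Subset n → Subset n → Set
  MeetsWithin lo hi A B =
    ∃ λ (v : Fin n) → (lo ≤ℕ toℕ v × toℕ v <ℕ hi) × v ∈ A × v ∈ B

  IntersectingWithin : ℕ → ℕ → Hypergraph n → Set
  IntersectingWithin lo hi ℋ =
    ∀ {A B} → A ∈ₗ ℋ → B ∈ₗ ℋ → MeetsWithin lo hi A B

  Separated : Subset n → Subset n → Set
  Separated A B = ∀ {a b} → a ∈ A → a ∉ B → b ∈ B → b ∉ A → a < b

  meetsWithin? : ∀ lo hi A B → Dec (MeetsWithin lo hi A B)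
  meetsWithin? lo hi A B =
    any? λ v → ((lo ≤? toℕ v) ×-dec (toℕ v <? hi)) ×-dec ((v ∈? A) ×-dec (v ∈? B))

  meetsAllWithin? : ∀ lo hi (ℋ : Hypergraph n) A → Dec (All (MeetsWithin lo hi A) ℋ)
  meetsAllWithin? lo hi ℋ A = all? (meetsWithin? lo hi A) ℋ

  intersectingWithin? : ∀ lo hi (ℋ : Hypergraph n) →
    IntersectingWithin lo hi ℋ ⊎
    ∃₂ λ A B → A ∈ₗ ℋ × B ∈ₗ ℋ × ¬ MeetsWithin lo hi A B
  intersectingWithin? lo hi ℋ with all? (meetsAllWithin? lo hi ℋ) ℋ
  ... | yes allMeet = inj₁ λ A∈ B∈ → lookup (lookup allMeet A∈) B∈
  ... | no ¬allMeet with find (¬All⇒Any¬ (meetsAllWithin? lo hi ℋ) ℋ ¬allMeet)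
  ...   | A , A∈ , ¬meetsAll with find (¬All⇒Any¬ (meetsWithin? lo hi A) ℋ ¬meetsAll)
  ...     | B , B∈ , ¬meets = inj₂ (A , B , A∈ , B∈ , ¬meets)

  meetsAtLowerEnd : ∀ {lo hi A B} → MeetsWithin lo hi A B →
    ¬ MeetsWithin (suc lo) hi A B → ∃ λ p → lo ≡ toℕ p × p ∈ A × p ∈ B
  meetsAtLowerEnd (p , (lo≤p , p<hi) , pA , pB) ¬meets with m≤n⇒m<n∨m≡n lo≤p
  ... | inj₁ lo<p = ⊥-elim (¬meets (p , (lo<p , p<hi) , pA , pB))
  ... | inj₂ lo≡p = p , lo≡p , pA , pB

  meetsAtUpperEnd : ∀ {lo hi A B} → MeetsWithin lo (suc hi) A B →
    ¬ MeetsWithin lo hi A B → ∃ λ q → hi ≡ toℕ q × q ∈ A × q ∈ B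
  meetsAtUpperEnd (q , (lo≤q , q<1+hi) , qA , qB) ¬meets with m≤n⇒m<n∨m≡n (s≤s⁻¹ q<1+hi)
  ... | inj₁ q<hi = ⊥-elim (¬meets (q , (lo≤q , q<hi) , qA , qB))
  ... | inj₂ q≡hi = q , sym q≡hi , qA , qB

  emptyWindow⇒pierced : ∀ {lo} {ℋ : Hypergraph n} →
    IntersectingWithin lo lo ℋ → PiercedByTwo ℋ
  emptyWindow⇒pierced {ℋ = []} _ = [] , z≤n , λ _ ()
  emptyWindow⇒pierced {ℋ = A ∷ _} I with I {A} (here refl) (here refl)
  ... | _ , (lo≤v , v<lo) , _ = ⊥-elim (≤⇒≯ lo≤v v<lo)

  module _ {ℋ : Hypergraph n} (aba : ABA-free ℋ) where

    ABA-free⇒separated : ∀ {A B a b} → A ∈ₗ ℋ → B ∈ₗ ℋ →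
      a ∈ A → a ∉ B → b ∈ B → b ∉ A → a < b → Separated A B
    ABA-free⇒separated {A} {B} {a} {b} A∈ B∈ aA aB bB bA a<b {a′} {b′} a′A a′B b′B b′A =
      a′<b′
      where
      a′<b : a′ < b
      a′<b with <-cmp a′ b
      ... | tri< lt _ _ = lt
      ... | tri≈ _ refl _ = ⊥-elim (a′B bB)
      ... | tri> _ _ b<a′ =
        ⊥-elim (aba A B A∈ B∈ a b a′ a<b b<a′ ((aA , aB) , (a′A , a′B) , (bB , bA)))
      a′<b′ : a′ < b′
      a′<b′ with <-cmp a′ b′
      ... | tri< lt _ _ = lt
      ... | tri≈ _ refl _ = ⊥-elim (a′B b′B)
      ... | tri> _ _ b′<a′ =
        ⊥-elim (aba B A B∈ A∈ b′ a′ b b′<a′ a′<b ((b′B , b′A) , (bB , bA) , (a′A , a′B)))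

    ABA-free⇒separated⊎separated : ∀ {A B a b} → A ∈ₗ ℋ → B ∈ₗ ℋ →
      a ∈ A → a ∉ B → b ∈ B → b ∉ A → Separated A B ⊎ Separated B A
    ABA-free⇒separated⊎separated {a = a} {b} A∈ B∈ aA aB bB bA with <-cmp a b
    ... | tri< a<b _ _ = inj₁ (ABA-free⇒separated A∈ B∈ aA aB bB bA a<b)
    ... | tri≈ _ refl _ = ⊥-elim (aB bB)
    ... | tri> _ _ b<a = inj₂ (ABA-free⇒separated B∈ A∈ bB bA aA aB b<a)

    module CriticalWindow {p q : Fin n}
      (I : IntersectingWithin (toℕ p) (suc (toℕ q)) ℋ)
      {A B C D : Subset n} (A∈ : A ∈ₗ ℋ) (B∈ : B ∈ₗ ℋ) (C∈ : C ∈ₗ ℋ) (D∈ : D ∈ₗ ℋ)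
      (pA : p ∈ A) (pB : p ∈ B) (qC : q ∈ C) (qD : q ∈ D)
      (¬AB : ¬ MeetsWithin (suc (toℕ p)) (suc (toℕ q)) A B)
      (¬CD : ¬ MeetsWithin (toℕ p) (toℕ q) C D) where

      Between : Fin n → Set
      Between v = p < v × v < q

      ApartBetween : Subset n → Subset n → Set
      ApartBetween X Y = ∀ {v} → Between v → v ∈ X → v ∈ Y → ⊥

      apart-sym : ∀ {X Y} → ApartBetween X Y → ApartBetween Y X
      apart-sym apart bv vY vX = apart bv vX vY

      between : ∀ {v} → p ≤ v → toℕ v <ℕ suc (toℕ q) → p ≢ v → v ≢ q → Between v
      between p≤v v<1+q p≢v v≢q = ≤∧≢⇒< p≤v p≢v , ≤∧≢⇒< (s≤s⁻¹ v<1+q) v≢q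

      apartAB : ApartBetween A B
      apartAB {v} (p<v , v<q) vA vB = ¬AB (v , (p<v , s≤s (<⇒≤ v<q)) , vA , vB)

      apartCD : ApartBetween C D
      apartCD {v} (p<v , v<q) vC vD = ¬CD (v , (<⇒≤ p<v , v<q) , vC , vD)

      crossing : ∀ {X Y Z U} → X ∈ₗ ℋ → Y ∈ₗ ℋ → Z ∈ₗ ℋ → U ∈ₗ ℋ →
        q ∉ X → q ∉ Y → p ∉ Z → p ∉ U → ApartBetween X Y → ApartBetween Z U →
        Separated X Y → Separated Z U → ⊥
      crossing X∈ Y∈ Z∈ U∈ qX qY pZ pU apartXY apartZU sepXY sepZU
        with I Y∈ Z∈ | I X∈ U∈
      ... | t , (p≤t , t<1+q) , tY , tZ | w , (p≤w , w<1+q) , wX , wU =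
        <-asym (sepXY wX (apartXY bw wX) tY (λ tX → apartXY bt tX tY))
               (sepZU tZ (apartZU bt tZ) wU (λ wZ → apartZU bw wZ wU))
        where
        bt : Between t
        bt = between p≤t t<1+q (λ { refl → pZ tZ }) (λ { refl → qY tY })
        bw : Between w
        bw = between p≤w w<1+q (λ { refl → pU wU }) (λ { refl → qX wX })

      meetsBetween : ∀ {E X} → E ∈ₗ ℋ → X ∈ₗ ℋ → p ∉ E → q ∉ E →
        ∃ λ v → Between v × v ∈ E × v ∈ X
      meetsBetween E∈ X∈ pE qE with I E∈ X∈
      ... | v , (p≤v , v<1+q) , vE , vX =
        v , between p≤v v<1+q (λ { refl → pE vE }) (λ { refl → qE vE }) , vE , vX

      ¬avoidsEnds : ∀ {E} → E ∈ₗ ℋ → p ∉ E → q ∉ E → ⊥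
      ¬avoidsEnds {E} E∈ pE qE
        with meetsBetween E∈ A∈ pE qE | meetsBetween E∈ B∈ pE qE
           | meetsBetween E∈ C∈ pE qE | meetsBetween E∈ D∈ pE qE
      ... | a , ba , aE , aA | b , bb , bE , bB | c , bc , cE , cC | d , bd , dE , dD =
        orient (ABA-free⇒separated⊎separated A∈ B∈ aA aB bB bA)
               (ABA-free⇒separated⊎separated C∈ D∈ cC cD dD dC)
        where
        ¬bothEnds : ∀ {X v} → X ∈ₗ ℋ → Between v → v ∈ E → v ∉ X → ¬ (p ∈ X × q ∈ X)
        ¬bothEnds {X} {v} X∈ (p<v , v<q) vE vX (pX , qX) =
          aba X E X∈ E∈ p v q p<v v<q ((pX , pE) , (qX , qE) , (vE , vX))
        aB : a ∉ B
        aB = apartAB ba aA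
        bA : b ∉ A
        bA bA′ = apartAB bb bA′ bB
        cD : c ∉ D
        cD = apartCD bc cC
        dC : d ∉ C
        dC dC′ = apartCD bd dC′ dD
        qA : q ∉ A
        qA qA′ = ¬bothEnds A∈ bb bE bA (pA , qA′)
        qB : q ∉ B
        qB qB′ = ¬bothEnds B∈ ba aE aB (pB , qB′)
        pC : p ∉ C
        pC pC′ = ¬bothEnds C∈ bd dE dC (pC′ , qC)
        pD : p ∉ D
        pD pD′ = ¬bothEnds D∈ bc cE cD (pD′ , qD)
        orient : Separated A B ⊎ Separated B A → Separated C D ⊎ Separated D C → ⊥
        orient (inj₁ sAB) (inj₁ sCD) =
          crossing A∈ B∈ C∈ D∈ qA qB pC pD apartAB apartCD sAB sCD
        orient (inj₂ sBA) (inj₁ sCD) =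
          crossing B∈ A∈ C∈ D∈ qB qA pC pD (apart-sym apartAB) apartCD sBA sCD
        orient (inj₁ sAB) (inj₂ sDC) =
          crossing A∈ B∈ D∈ C∈ qA qB pD pC apartAB (apart-sym apartCD) sAB sDC
        orient (inj₂ sBA) (inj₂ sDC) =
          crossing B∈ A∈ D∈ C∈ qB qA pD pC (apart-sym apartAB) (apart-sym apartCD) sBA sDC

      hits : ∀ {E} → E ∈ₗ ℋ → p ∈ E ⊎ q ∈ E
      hits {E} E∈ with p ∈? E | q ∈? E
      ... | yes pE | _ = inj₁ pE
      ... | no _ | yes qE = inj₂ qE
      ... | no pE | no qE = ⊥-elim (¬avoidsEnds E∈ pE qE)

    criticalWindow⇒pierced : ∀ {lo hi A B C D} →
      IntersectingWithin lo (suc hi) ℋ →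
      A ∈ₗ ℋ → B ∈ₗ ℋ → ¬ MeetsWithin (suc lo) (suc hi) A B →
      C ∈ₗ ℋ → D ∈ₗ ℋ → ¬ MeetsWithin lo hi C D → PiercedByTwo ℋ
    criticalWindow⇒pierced I A∈ B∈ ¬AB C∈ D∈ ¬CD
      with meetsAtLowerEnd (I A∈ B∈) ¬AB | meetsAtUpperEnd (I C∈ D∈) ¬CD
    ... | p , refl , pA , pB | q , refl , qC , qD =
      p ∷ q ∷ [] , s≤s (s≤s z≤n) ,
      λ E E∈ → [ (λ pE → p , here refl , pE) , (λ qE → q , there (here refl) , qE) ]′
                 (CriticalWindow.hits I A∈ B∈ C∈ D∈ pA pB qC qD ¬AB ¬CD E∈)

    shrinkWindow⇒pierced : ∀ k lo → IntersectingWithin lo (k + lo) ℋ → PiercedByTwo ℋ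
    shrinkWindow⇒pierced zero lo I = emptyWindow⇒pierced I
    shrinkWindow⇒pierced (suc k) lo I with intersectingWithin? (suc lo) (suc (k + lo)) ℋ
    ... | inj₁ I′ = shrinkWindow⇒pierced k (suc lo) (subst upTo (sym (+-suc k lo)) I′)
      where
      upTo : ℕ → Set
      upTo hi = IntersectingWithin (suc lo) hi ℋ
    ... | inj₂ (A , B , A∈ , B∈ , ¬AB) with intersectingWithin? lo (k + lo) ℋ
    ...   | inj₁ I′ = shrinkWindow⇒pierced k lo I′
    ...   | inj₂ (C , D , C∈ , D∈ , ¬CD) = criticalWindow⇒pierced I A∈ B∈ ¬AB C∈ D∈ ¬CD

mainTheorem1 : (n : ℕ) (ℋ : Hypergraph n) →
    ABA-free ℋ → Intersecting ℋ → PiercedByTwo ℋ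
mainTheorem1 n ℋ aba intersecting = shrinkWindow⇒pierced aba n 0 withinAll
  where
  withinAll : IntersectingWithin 0 (n + 0) ℋ
  withinAll {A} {B} A∈ B∈ with intersecting A B A∈ B∈
  ... | v , vA , vB = v , (z≤n , m≤n⇒m≤n+o 0 (toℕ<n v)) , vA , vB
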